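{- Let $\Psi$ be a sublanguage of $\mathcal{L}$ containing $\backslash$ or containing $/$. Then the Hilbert system $\mathbf{e}\mathcal{FL}[\Psi]$ is protoalgebraic.
   Context: Let $\mathcal{L}$ be the propositional language with binary connectives $\vee,\wedge,*,\backslash,/$, unary connectives $\neg_r$ (right negation) and $\neg_l$ (left negation), and constants $0,1$; formulas are built from countably many variables. A sequent is $\Gamma\Rightarrow\Delta$ with $\Gamma$ a finite (possibly empty) sequence of formulas and $\Delta$ of length at most one ($\emptyset$ = empty sequence). The calculus $\mathbf{FL}$ has the structural axiom $\varphi\Rightarrow\varphi$ and rule (Cut): from $\Gamma\Rightarrow\varphi$ and $\Sigma,\varphi,\Pi\Rightarrow\Delta$ infer $\Sigma,\Gamma,\Pi\Rightarrow\Delta$; and the connective rules: ($\vee\Rightarrow$) from $\Sigma,\varphi,\Gamma\Rightarrow\Delta$ and $\Sigma,\psi,\Gamma\Rightarrow\Delta$ infer $\Sigma,\varphi\vee\psi,\Gamma\Rightarrow\Delta$; ($\Rightarrow\vee$) from $\Gamma\Rightarrow\varphi$ infer $\Gamma\Rightarrow\varphi\vee\psi$ and $\Gamma\Rightarrow\psi\vee\varphi$; ($\wedge\Rightarrow$) from $\Sigma,\varphi,\Gamma\Rightarrow\Delta$ infer $\Sigma,\varphi\wedge\psi,\Gamma\Rightarrow\Delta$ and $\Sigma,\psi\wedge\varphi,\Gamma\Rightarrow\Delta$; ($\Rightarrow\wedge$) from $\Gamma\Rightarrow\varphi$, $\Gamma\Rightarrow\psi$ infer $\Gamma\Rightarrow\varphi\wedge\psi$;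 ($*\Rightarrow$) from $\Sigma,\varphi,\psi,\Gamma\Rightarrow\Delta$ infer $\Sigma,\varphi*\psi,\Gamma\Rightarrow\Delta$; ($\Rightarrow*$) from $\Gamma\Rightarrow\varphi$, $\Pi\Rightarrow\psi$ infer $\Gamma,\Pi\Rightarrow\varphi*\psi$; ($\backslash\Rightarrow$) from $\Gamma\Rightarrow\varphi$ and $\Sigma,\psi,\Pi\Rightarrow\Delta$ infer $\Sigma,\Gamma,\varphi\backslash\psi,\Pi\Rightarrow\Delta$; ($\Rightarrow\backslash$) from $\varphi,\Gamma\Rightarrow\psi$ infer $\Gamma\Rightarrow\varphi\backslash\psi$; ($/\Rightarrow$) from $\Gamma\Rightarrow\varphi$ and $\Sigma,\psi,\Pi\Rightarrow\Delta$ infer $\Sigma,\psi/\varphi,\Gamma,\Pi\Rightarrow\Delta$; ($\Rightarrow/$) from $\Gamma,\varphi\Rightarrow\psi$ infer $\Gamma\Rightarrow\psi/\varphi$; ($\neg_r\Rightarrow$) from $\Gamma\Rightarrow\varphi$ infer $\Gamma,\neg_r\varphi\Rightarrow\emptyset$; ($\Rightarrow\neg_r$) from $\varphi,\Gamma\Rightarrow\emptyset$ infer $\Gamma\Rightarrow\neg_r\varphi$; ($\neg_l\Rightarrow$) from $\Gamma\Rightarrow\varphi$ infer $\neg_l\varphi,\Gamma\Rightarrow\emptyset$; ($\Rightarrow\neg_l$) from $\Gamma,\varphi\Rightarrow\emptyset$ infer $\Gamma\Rightarrow\neg_l\varphi$; for $1$: axiom $\emptyset\Rightarrow1$ and rule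 from $\Sigma,\Gamma\Rightarrow\Delta$ infer $\Sigma,1,\Gamma\Rightarrow\Delta$; for $0$: axiom $0\Rightarrow\emptyset$ and rule from $\Gamma\Rightarrow\emptyset$ infer $\Gamma\Rightarrow0$. For a sublanguage $\Psi$, $\mathbf{FL}[\Psi]$ uses $\Psi$-formulas, the structural axiom and (Cut), and only the rules/axioms of connectives and constants in $\Psi$; the Gentzen system $\mathcal{FL}[\Psi]$: $\Phi\vdash\varsigma$ iff there is a finite sequence ending in $\varsigma$ each member of which is an axiom instance, in $\Phi$, or obtained from earlier members by a rule instance. The Hilbert system $\mathbf{e}\mathcal{FL}[\Psi]$ on $\Psi$-formulas: $\Sigma\vdash\varphi$ iff $\{\emptyset\Rightarrow\psi:\psi\in\Sigma\}\vdash_{\mathcal{FL}[\Psi]}\emptyset\Rightarrow\varphi$. A theory is a set of formulas closed under $\vdash$; the Leibniz congruence $\Omega T$ of a theory $T$ is the largest congruence $\theta$ of the formula algebra compatible with $T$ ($\langle\varphi,\psi\rangle\in\theta$ and $\varphi\in T$ imply $\psi\in T$). A Hilbert system is protoalgebraic if for all theories $T_1\subseteq T_2$ we have $\Omega T_1\subseteq\Omega T_2$. -}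

module Defs where

open import Data.Nat using (ℕ)
open import Data.Bool using (Bool; T)
open import Data.List using (List; []; _∷_; _++_; [_])
open import Data.Maybe using (Maybe; just; nothing)
open import Data.Product using (Σ; _×_; _,_)
open import Relation.Binary.PropositionalEquality using (_≡_)

data Bin : Set where
  or and prod ldiv rdiv : Bin

data Un : Set where
  negr negl : Un

data Const : Set where
  c0 c1 : Const

data Conn : Set where
  b : Bin → Conn
  u : Un → Conn
  k : Const → Conn

Sublanguage : Set
Sublanguage = Conn → Bool

data Fm (Ψ : Sublanguage) : Set where
  var : ℕ → Fm Ψ
  bin : (c : Bin) → T (Ψ (b c)) → Fm Ψ → Fm Ψ → Fm Ψ
  un  : (c : Un) → T (Ψ (u c)) → Fm Ψ → Fm Ψ
  con : (c : Const) → T (Ψ (k c)) → Fm Ψ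

-- Sequents Γ ⇒ Δ, with Δ of length at most one (nothing = empty)

record Seq (Ψ : Sublanguage) : Set where
  constructor _⇒_
  field
    ante : List (Fm Ψ)
    succ : Maybe (Fm Ψ)

infix 4 _⇒_

data _⊢G_ {Ψ : Sublanguage} (Φ : Seq Ψ → Set) : Seq Ψ → Set where
  hyp  : ∀ {s} → Φ s → Φ ⊢G s
  ax   : ∀ {φ} → Φ ⊢G ([ φ ] ⇒ just φ)
  cut  : ∀ {Γ Σ' Π Δ φ} → Φ ⊢G (Γ ⇒ just φ) → Φ ⊢G ((Σ' ++ φ ∷ Π) ⇒ Δ)
         → Φ ⊢G ((Σ' ++ Γ ++ Π) ⇒ Δ)
  ∨L   : ∀ {Σ' Γ Δ φ ψ} (p : T (Ψ (b or)))
         → Φ ⊢G ((Σ' ++ φ ∷ Γ) ⇒ Δ) → Φ ⊢G ((Σ' ++ ψ ∷ Γ) ⇒ Δ)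
         → Φ ⊢G ((Σ' ++ bin or p φ ψ ∷ Γ) ⇒ Δ)
  ∨R₁  : ∀ {Γ φ ψ} (p : T (Ψ (b or)))
         → Φ ⊢G (Γ ⇒ just φ) → Φ ⊢G (Γ ⇒ just (bin or p φ ψ))
  ∨R₂  : ∀ {Γ φ ψ} (p : T (Ψ (b or)))
         → Φ ⊢G (Γ ⇒ just φ) → Φ ⊢G (Γ ⇒ just (bin or p ψ φ))
  ∧L₁  : ∀ {Σ' Γ Δ φ ψ} (p : T (Ψ (b and)))
         → Φ ⊢G ((Σ' ++ φ ∷ Γ) ⇒ Δ) → Φ ⊢G ((Σ' ++ bin and p φ ψ ∷ Γ) ⇒ Δ)
  ∧L₂  : ∀ {Σ' Γ Δ φ ψ} (p : T (Ψ (b and)))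
         → Φ ⊢G ((Σ' ++ φ ∷ Γ) ⇒ Δ) → Φ ⊢G ((Σ' ++ bin and p ψ φ ∷ Γ) ⇒ Δ)
  ∧R   : ∀ {Γ φ ψ} (p : T (Ψ (b and)))
         → Φ ⊢G (Γ ⇒ just φ) → Φ ⊢G (Γ ⇒ just ψ) → Φ ⊢G (Γ ⇒ just (bin and p φ ψ))
  *L   : ∀ {Σ' Γ Δ φ ψ} (p : T (Ψ (b prod)))
         → Φ ⊢G ((Σ' ++ φ ∷ ψ ∷ Γ) ⇒ Δ) → Φ ⊢G ((Σ' ++ bin prod p φ ψ ∷ Γ) ⇒ Δ)
  *R   : ∀ {Γ Π φ ψ} (p : T (Ψ (b prod)))
         → Φ ⊢G (Γ ⇒ just φ) → Φ ⊢G (Π ⇒ just ψ) → Φ ⊢G ((Γ ++ Π) ⇒ just (bin prod p φ ψ))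
  -- \   (bin ldiv p φ ψ  is  φ \ ψ)
  ldivL : ∀ {Γ Σ' Π Δ φ ψ} (p : T (Ψ (b ldiv)))
         → Φ ⊢G (Γ ⇒ just φ) → Φ ⊢G ((Σ' ++ ψ ∷ Π) ⇒ Δ)
         → Φ ⊢G ((Σ' ++ Γ ++ bin ldiv p φ ψ ∷ Π) ⇒ Δ)
  ldivR : ∀ {Γ φ ψ} (p : T (Ψ (b ldiv)))
         → Φ ⊢G ((φ ∷ Γ) ⇒ just ψ) → Φ ⊢G (Γ ⇒ just (bin ldiv p φ ψ))
  -- /   (bin rdiv p ψ φ  is  ψ / φ)
  rdivL : ∀ {Γ Σ' Π Δ φ ψ} (p : T (Ψ (b rdiv)))
         → Φ ⊢G (Γ ⇒ just φ) → Φ ⊢G ((Σ' ++ ψ ∷ Π) ⇒ Δ)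
         → Φ ⊢G ((Σ' ++ bin rdiv p ψ φ ∷ Γ ++ Π) ⇒ Δ)
  rdivR : ∀ {Γ φ ψ} (p : T (Ψ (b rdiv)))
         → Φ ⊢G ((Γ ++ [ φ ]) ⇒ just ψ) → Φ ⊢G (Γ ⇒ just (bin rdiv p ψ φ))
  ¬rL  : ∀ {Γ φ} (p : T (Ψ (u negr)))
         → Φ ⊢G (Γ ⇒ just φ) → Φ ⊢G ((Γ ++ [ un negr p φ ]) ⇒ nothing)
  ¬rR  : ∀ {Γ φ} (p : T (Ψ (u negr)))
         → Φ ⊢G ((φ ∷ Γ) ⇒ nothing) → Φ ⊢G (Γ ⇒ just (un negr p φ))
  ¬lL  : ∀ {Γ φ} (p : T (Ψ (u negl)))
         → Φ ⊢G (Γ ⇒ just φ) → Φ ⊢G ((un negl p φ ∷ Γ) ⇒ nothing)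
  ¬lR  : ∀ {Γ φ} (p : T (Ψ (u negl)))
         → Φ ⊢G ((Γ ++ [ φ ]) ⇒ nothing) → Φ ⊢G (Γ ⇒ just (un negl p φ))
  1ax  : (p : T (Ψ (k c1))) → Φ ⊢G ([] ⇒ just (con c1 p))
  1L   : ∀ {Σ' Γ Δ} (p : T (Ψ (k c1)))
         → Φ ⊢G ((Σ' ++ Γ) ⇒ Δ) → Φ ⊢G ((Σ' ++ con c1 p ∷ Γ) ⇒ Δ)
  0ax  : (p : T (Ψ (k c0))) → Φ ⊢G ([ con c0 p ] ⇒ nothing)
  0R   : ∀ {Γ} (p : T (Ψ (k c0)))
         → Φ ⊢G (Γ ⇒ nothing) → Φ ⊢G (Γ ⇒ just (con c0 p))

asSeqs : {Ψ : Sublanguage} → (Fm Ψ → Set) → Seq Ψ → Set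
asSeqs {Ψ} S s = Σ (Fm Ψ) λ ψ → S ψ × (s ≡ ([] ⇒ just ψ))

_⊢H_ : {Ψ : Sublanguage} → (Fm Ψ → Set) → Fm Ψ → Set
S ⊢H φ = asSeqs S ⊢G ([] ⇒ just φ)

IsTheory : {Ψ : Sublanguage} → (Fm Ψ → Set) → Set
IsTheory {Ψ} T' = (φ : Fm Ψ) → T' ⊢H φ → T' φ

Rel' : Sublanguage → Set₁
Rel' Ψ = Fm Ψ → Fm Ψ → Set

record IsCongruence {Ψ : Sublanguage} (θ : Rel' Ψ) : Set where
  field
    refl'  : ∀ {φ} → θ φ φ
    sym'   : ∀ {φ ψ} → θ φ ψ → θ ψ φ
    trans' : ∀ {φ ψ χ} → θ φ ψ → θ ψ χ → θ φ χ
    binC   : ∀ c (p : T (Ψ (b c))) {φ φ' ψ ψ'} → θ φ φ' → θ ψ ψ'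
             → θ (bin c p φ ψ) (bin c p φ' ψ')
    unC    : ∀ c (p : T (Ψ (u c))) {φ φ'} → θ φ φ' → θ (un c p φ) (un c p φ')

Compatible : {Ψ : Sublanguage} → (Fm Ψ → Set) → Rel' Ψ → Set
Compatible T' θ = ∀ {φ ψ} → θ φ ψ → T' φ → T' ψ

-- Ω T: the largest congruence compatible with T, i.e. the union of all
-- congruences compatible with T (which is itself such a congruence).
Ω : {Ψ : Sublanguage} → (Fm Ψ → Set) → Fm Ψ → Fm Ψ → Set₁
Ω {Ψ} T' φ ψ = Σ (Rel' Ψ) λ θ → IsCongruence θ × Compatible T' θ × θ φ ψ

Protoalgebraic : Sublanguage → Set₁
Protoalgebraic Ψ =
  (T₁ T₂ : Fm Ψ → Set) → IsTheory T₁ → IsTheory T₂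
  → (∀ φ → T₁ φ → T₂ φ)
  → ∀ φ ψ → Ω T₁ φ ψ → Ω T₂ φ ψ

-- A binary term a ⇛ c with ⊢ c ⇛ c and modus ponens a, a ⇛ c ⊢ c makes any
-- logic protoalgebraic: if θ is a congruence compatible with a theory T₁ and
-- θ a c, then θ (a ⇛ c) (c ⇛ c), so a ⇛ c ∈ T₁; hence for every theory
-- T₂ ⊇ T₁, a ∈ T₂ gives c ∈ T₂ by modus ponens. So θ stays compatible with T₂.
-- In FL[Ψ] both residuals a \ c and c / a are such terms.
module Submission where

open import Defs
open import Data.Bool using (T)
open import Data.Sum using (_⊎_; inj₁; inj₂)
open import Data.Product using (_,_)
open import Data.List using ([]; _∷_; _++_; [_])
open import Data.Maybe using (Maybe; just)
open import Relation.Binary.PropositionalEquality using (refl)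

module _ {Ψ : Sublanguage} {Φ : Seq Ψ → Set} where

  cut-theorem : ∀ {Σ' Π φ} {Δ : Maybe (Fm Ψ)} → Φ ⊢G ([] ⇒ just φ)
              → Φ ⊢G ((Σ' ++ φ ∷ Π) ⇒ Δ) → Φ ⊢G ((Σ' ++ Π) ⇒ Δ)
  cut-theorem = cut {Γ = []}

assumption : ∀ {Ψ} {S : Fm Ψ → Set} {φ} → S φ → S ⊢H φ
assumption sφ = hyp (_ , sφ , refl)

record ProtoImplication (Ψ : Sublanguage) : Set₁ where
  field
    _⇛_          : Fm Ψ → Fm Ψ → Fm Ψ
    ⇛-refl       : ∀ {S : Fm Ψ → Set} φ → S ⊢H (φ ⇛ φ)
    modus-ponens : ∀ {S : Fm Ψ → Set} {φ ψ} → S φ → S (φ ⇛ ψ) → S ⊢H ψ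
    ⇛-cong       : ∀ {θ : Rel' Ψ} → IsCongruence θ
                 → ∀ {φ φ' ψ ψ'} → θ φ φ' → θ ψ ψ' → θ (φ ⇛ ψ) (φ' ⇛ ψ')

ldiv-protoImplication : ∀ {Ψ} → T (Ψ (b ldiv)) → ProtoImplication Ψ
ldiv-protoImplication p = record
  { _⇛_          = bin ldiv p
  ; ⇛-refl       = λ _ → ldivR p ax
  ; modus-ponens = λ sφ sφ⇛ψ →
      cut-theorem {Σ' = []} (assumption sφ⇛ψ)
        (cut-theorem {Σ' = []} (assumption sφ)
          (ldivL {Σ' = []} {Π = []} p ax ax))
  ; ⇛-cong       = λ cg → IsCongruence.binC cg ldiv p
  }

rdiv-protoImplication : ∀ {Ψ} → T (Ψ (b rdiv)) → ProtoImplication Ψ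
rdiv-protoImplication p = record
  { _⇛_          = λ φ ψ → bin rdiv p ψ φ
  ; ⇛-refl       = λ _ → rdivR {Γ = []} p ax
  ; modus-ponens = λ sφ sφ⇛ψ →
      cut-theorem {Σ' = []} (assumption sφ⇛ψ)
        (cut-theorem {Σ' = [ _ ]} (assumption sφ)
          (rdivL {Γ = [ _ ]} {Σ' = []} {Π = []} p ax ax))
  ; ⇛-cong       = λ cg θφφ' θψψ' → IsCongruence.binC cg rdiv p θψψ' θφφ'
  }

module _ {Ψ : Sublanguage} (J : ProtoImplication Ψ) where
  open ProtoImplication J

  compatible-⊆ : ∀ {T₁ T₂ : Fm Ψ → Set} {θ : Rel' Ψ}
               → IsTheory T₁ → IsTheory T₂ → (∀ φ → T₁ φ → T₂ φ)
               → IsCongruence θ → Compatible T₁ θ → Compatible T₂ θ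
  compatible-⊆ {T₁} {T₂} {θ} th₁ th₂ T₁⊆T₂ cg comp₁ {φ} {ψ} θφψ T₂φ =
    th₂ ψ (modus-ponens T₂φ (T₁⊆T₂ _ φ⇛ψ∈T₁))
    where
    open IsCongruence cg
    φ⇛ψ∈T₁ : T₁ (φ ⇛ ψ)
    φ⇛ψ∈T₁ = comp₁ (⇛-cong cg (sym' θφψ) refl') (th₁ _ (⇛-refl ψ))

  protoalgebraic : Protoalgebraic Ψ
  protoalgebraic T₁ T₂ th₁ th₂ T₁⊆T₂ φ ψ (θ , cg , comp₁ , θφψ) =
    θ , cg , compatible-⊆ th₁ th₂ T₁⊆T₂ cg comp₁ , θφψ

corollary9 : (Ψ : Sublanguage) → T (Ψ (b ldiv)) ⊎ T (Ψ (b rdiv)) → Protoalgebraic Ψ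
corollary9 Ψ (inj₁ p) = protoalgebraic (ldiv-protoImplication p)
corollary9 Ψ (inj₂ p) = protoalgebraic (rdiv-protoImplication p)
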